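{- Let $n\ge 1$, $k\in\mathbb{Z}$ and $a\in\mathbb{C}$ with $a\neq0$. Then \[ PC_{n}^{(k)}(x:a)=-PC_{n-1}^{(k)}(x:a)-\frac{1}{a}\,x\,PC_{n-1}^{(k)}(x+1:a)+\frac{1}{n}\sum_{l=0}^{n-1}\binom{n}{l}\frac{\hat{C}_{l}}{a^{l}}\left\{PC_{n-l}^{(k-1)}(x:a)-PC_{n-l}^{(k)}(x:a)\right\}. \]
   Context: For an integer $k$, $\mathrm{Lif}_k(t)=\sum_{n=0}^{\infty}\frac{t^{n}}{n!\,(n+1)^{k}}$. For $a\neq0$ and any integer $k$, $PC_n^{(k)}(x:a)$ is defined by $e^{ -t}\,\mathrm{Lif}_k\!\left(\log\left(1+\frac{t}{a}\right)\right)\left(1+\frac{t}{a}\right)^{ -x}=\sum_{n\ge0}PC_n^{(k)}(x:a)\frac{t^n}{n!}$. The Cauchy numbers of the second kind $\hat{C}_n$ are defined by $\frac{t}{(1+t)\log(1+t)}=\sum_{n\ge0}\hat{C}_n\frac{t^n}{n!}$. -}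

module Defs where

open import Level using (Level; _⊔_) renaming (suc to lsuc)
open import Algebra.Bundles using (CommutativeRing)
open import Data.Nat using (ℕ; zero; suc; _∸_)
open import Data.Nat.Combinatorics using (_C_)
import Data.Nat as ℕ
open import Data.Integer using (ℤ; +_; -[1+_])
open import Relation.Nullary using (¬_)

natR : {c ℓ : Level} (R : CommutativeRing c ℓ) → ℕ → CommutativeRing.Carrier R
natR R zero    = CommutativeRing.0# R
natR R (suc n) = CommutativeRing._+_ R (CommutativeRing.1# R) (natR R n)

-- A field of characteristic zero (e.g. ℂ).  The ring is a stdlib
-- CommutativeRing; inverses are given for nonzero elements.
record CharZeroField (c ℓ : Level) : Set (lsuc (c ⊔ ℓ)) where
  field
    cring : CommutativeRing c ℓ
  private module R = CommutativeRing cring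
  field
    inv      : (x : R.Carrier) → ¬ (x R.≈ R.0#) → R.Carrier
    inv-r    : (x : R.Carrier) (p : ¬ (x R.≈ R.0#)) → (x R.* inv x p) R.≈ R.1#
    charZero : (n : ℕ) → ¬ (natR cring (suc n) R.≈ R.0#)
  open CommutativeRing cring public

  natC : ℕ → Carrier
  natC = natR cring

module _ {c ℓ : Level} (F : CharZeroField c ℓ) where
  open CharZeroField F

  sumTo : (ℕ → Carrier) → ℕ → Carrier
  sumTo f zero    = 0#
  sumTo f (suc n) = sumTo f n + f n

  pw : Carrier → ℕ → Carrier
  pw x zero    = 1#
  pw x (suc m) = x * pw x m

  sign : ℕ → Carrier
  sign m = pw (- 1#) m

  invN : ℕ → Carrier
  invN n = inv (natC (suc n)) (charZero n)

  invFact : ℕ → Carrier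
  invFact zero    = 1#
  invFact (suc m) = invN m * invFact m

  Series : Set c
  Series = ℕ → Carrier

  oneS : Series
  oneS zero    = 1#
  oneS (suc _) = 0#

  mulS : Series → Series → Series
  mulS f g n = sumTo (λ i → f i * g (n ∸ i)) (suc n)

  powS : Series → ℕ → Series
  powS s zero    = oneS
  powS s (suc j) = mulS s (powS s j)

  -- composition  (Σ_j c_j u^j) ∘ s,  for s with zero constant term
  compS : Series → Series → Series
  compS cf s n = sumTo (λ j → cf j * powS s j n) (suc n)

  expNeg : Series
  expNeg m = sign m * invFact m

  -- Lif_k(u) = Σ_j u^j / (j! (j+1)^k),   k ∈ ℤ
  lifCoeff : ℤ → Series
  lifCoeff (+ m)     j = invFact j * pw (invN j) m
  lifCoeff -[1+ m ]  j = invFact j * pw (natC (suc j)) (suc m)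

  expCoeff : Series
  expCoeff j = invFact j

  module _ (a : Carrier) (a≉0 : ¬ (a ≈ 0#)) where
    ainv : Carrier
    ainv = inv a a≉0

    -- log(1 + t/a) = Σ_{m≥1} (-1)^{m-1} t^m / (m a^m)
    logA : Series
    logA zero    = 0#
    logA (suc m) = sign m * pw ainv (suc m) * invN m

    -- (1 + t/a)^{-x} = exp(-x log(1 + t/a))
    powX : Carrier → Series
    powX x m = - x * logA m

    genPC : ℤ → Carrier → Series
    genPC k x = mulS expNeg (mulS (compS (lifCoeff k) logA) (compS expCoeff (powX x)))

    -- PC_n^{(k)}(x:a) = n! [t^n] e^{-t} Lif_k(log(1+t/a)) (1+t/a)^{-x}
    PC : ℤ → Carrier → ℕ → Carrier
    PC k x n = natC (n ℕ.!) * genPC k x n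

  logOverT : Series
  logOverT m = sign m * invN m

  onePlusT : Series
  onePlusT zero          = 1#
  onePlusT (suc zero)    = 1#
  onePlusT (suc (suc _)) = 0#

  -- q(t) = (1+t) log(1+t)/t, with q 0 = 1
  qS : Series
  qS = mulS onePlusT logOverT

  -- 1/q = Σ_j (1 - q)^j   (geometric series composed with 1-q, zero constant term)
  invQ : Series
  invQ = compS (λ _ → 1#) (λ m → oneS m - qS m)

  -- Cauchy numbers of the second kind:  t/((1+t)log(1+t)) = Σ Ĉ_n t^n/n!
  Chat : ℕ → Carrier
  Chat n = natC (n ℕ.!) * invQ n

  binom : ℕ → ℕ → Carrier
  binom n l = natC (n C l)

-- Work with formal power series in t and put u = t/a.  The generating function of PC^(k)(x:a) is
-- G k x = e^(-t) Λ k E x with Λ k = Lif_k(L), L = log(1+u), E x = (1+u)^(-x), and the recurrence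
-- is the coefficient of t^(n-1) in a formula for the derivative G′:
--   * (e^(-t))′ = -e^(-t);
--   * (E x)′ = -(x/a) E x/(1+u), and E x/(1+u) = E (x+1) because both solve the linear ODE
--     (1+u) y′ = -((x+1)/a) y with y(0) = 1;
--   * (Λ k)′ = Lif_k′(L) L′ and L′ = (1/a)/(1+u) = Ĉ(u) · L/t, where Ĉ(u) = u/((1+u) log(1+u))
--     is the generating function of Ĉₙ/n!;
--   * Lif_(k-1)(v) = Lif_k(v) + v Lif_k′(v), hence t · e^(-t) Lif_k′(L) (L/t) E x = G (k-1) x - G k x.
-- Altogether G′ = -G - (x/a) G(x+1) + Ĉ(u) (G (k-1) x - G k x)/t.

module Submission where

open import Level using (Level)
open import Algebra.Bundles using (CommutativeRing)
open import Data.Nat as ℕ using (ℕ; zero; suc; _∸_; _≤_; _<_; _!; s≤s; z≤n)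
import Data.Nat.Properties as ℕ
open import Data.Nat.Combinatorics using (_C_; nCk≡n!/k![n-k]!; k![n∸k]!∣n!)
open import Data.Nat.DivMod using (m/n*n≡m)
open import Data.Integer as ℤ using (ℤ; +_; -[1+_]; 0ℤ; 1ℤ; _⊖_; ∣_∣; _◃_) renaming (_-_ to _-ℤ_)
import Data.Integer.Properties as ℤ
open import Data.Sign as Sign using (Sign)
open import Data.Maybe using (map)
open import Data.Product using (_,_)
open import Function using (_∘_)
open import Relation.Binary.Consequences using (dec⇒weaklyDec)
open import Relation.Binary.PropositionalEquality as ≡ using (_≡_)
open import Relation.Nullary using (¬_)
import Relation.Binary.Reasoning.Setoid as SetoidReasoning
import Algebra.Solver.Ring.AlmostCommutativeRing as ACR
import Algebra.Solver.Ring
open import Defs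

-- Algebra.Solver.Ring can only cancel coefficients whose equality it decides;
-- ℤ, mapped canonically into R, serves as such a coefficient ring for every R.
module ℤ-RingSolver {c ℓ : Level} (R : CommutativeRing c ℓ) where
  open CommutativeRing R
  open import Algebra.Properties.Ring ring
  open import Algebra.Properties.Semiring.Mult.TCOptimised semiring
  open import Algebra.Properties.CommutativeSemigroup +-commutativeSemigroup
    using () renaming (interchange to +-interchange)
  open import Algebra.Properties.CommutativeSemigroup *-commutativeSemigroup
    using () renaming (interchange to *-interchange)
  open import Relation.Binary.Reasoning.Setoid setoid

  natR≈×1 : ∀ n → natR R n ≈ n × 1#
  natR≈×1 zero    = refl
  natR≈×1 (suc n) = trans (+-congˡ (natR≈×1 n)) (sym (1+× n 1#))

  natR-+ : ∀ m n → natR R (m ℕ.+ n) ≈ natR R m + natR R n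
  natR-+ m n = trans (natR≈×1 (m ℕ.+ n))
    (trans (×-homo-+ 1# m n) (sym (+-cong (natR≈×1 m) (natR≈×1 n))))

  natR-* : ∀ m n → natR R (m ℕ.* n) ≈ natR R m * natR R n
  natR-* m n = trans (natR≈×1 (m ℕ.* n))
    (trans (×1-homo-* m n) (sym (*-cong (natR≈×1 m) (natR≈×1 n))))

  -- With this (tail-optimised) multiple, 1 × 1# is 1# itself, so the solver's
  -- constant 1ℤ denotes the literal 1# of R.
  intR : ℤ → Carrier
  intR (+ n)    = n × 1#
  intR -[1+ n ] = - (suc n × 1#)

  signR : Sign → Carrier
  signR Sign.+ = 1#
  signR Sign.- = - 1#

  signR-* : ∀ s t → signR (s Sign.* t) ≈ signR s * signR t
  signR-* Sign.+ t      = sym (*-identityˡ _)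
  signR-* Sign.- Sign.+ = sym (*-identityʳ _)
  signR-* Sign.- Sign.- = sym (trans (-1*x≈-x _) (-‿involutive _))

  intR-◃ : ∀ s n → intR (s ◃ n) ≈ signR s * (n × 1#)
  intR-◃ s      zero    = sym (zeroʳ _)
  intR-◃ Sign.+ (suc n) = sym (*-identityˡ _)
  intR-◃ Sign.- (suc n) = sym (-1*x≈-x _)

  intR-signAbs : ∀ i → intR i ≈ signR (ℤ.sign i) * (∣ i ∣ × 1#)
  intR-signAbs (+ n)    = sym (*-identityˡ _)
  intR-signAbs -[1+ n ] = sym (-1*x≈-x _)

  intR-⊖ : ∀ m n → intR (m ⊖ n) ≈ m × 1# - n × 1#
  intR-⊖ m       zero    = sym (trans (+-congˡ -0#≈0#) (+-identityʳ _))
  intR-⊖ zero    (suc n) = sym (+-identityˡ _)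
  intR-⊖ (suc m) (suc n) = begin
    intR (suc m ⊖ suc n)            ≡⟨ ≡.cong intR (ℤ.[1+m]⊖[1+n]≡m⊖n m n) ⟩
    intR (m ⊖ n)                    ≈⟨ intR-⊖ m n ⟩
    m × 1# - n × 1#                 ≈⟨ +-identityˡ _ ⟨
    0# + (m × 1# - n × 1#)          ≈⟨ +-congʳ (-‿inverseʳ 1#) ⟨
    (1# - 1#) + (m × 1# - n × 1#)   ≈⟨ +-interchange _ _ _ _ ⟩
    (1# + m × 1#) + (- 1# - n × 1#) ≈⟨ +-congˡ (-‿+-comm _ _) ⟩
    (1# + m × 1#) - (1# + n × 1#)   ≈⟨ +-cong (1+× m 1#) (-‿cong (1+× n 1#)) ⟨
    suc m × 1# - suc n × 1#         ∎

  intR-+ : ∀ i j → intR (i ℤ.+ j) ≈ intR i + intR j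
  intR-+ (+ m)    (+ n)    = ×-homo-+ 1# m n
  intR-+ (+ m)    -[1+ n ] = intR-⊖ m (suc n)
  intR-+ -[1+ m ] (+ n)    = trans (intR-⊖ n (suc m)) (+-comm _ _)
  intR-+ -[1+ m ] -[1+ n ] = begin
    - (suc (suc (m ℕ.+ n)) × 1#)        ≡⟨ ≡.cong (λ k → - (suc k × 1#)) (ℕ.+-suc m n) ⟨
    - ((suc m ℕ.+ suc n) × 1#)          ≈⟨ -‿cong (×-homo-+ 1# (suc m) (suc n)) ⟩
    - (suc m × 1# + suc n × 1#)         ≈⟨ -‿+-comm _ _ ⟨
    - (suc m × 1#) - (suc n × 1#)       ∎

  intR-* : ∀ i j → intR (i ℤ.* j) ≈ intR i * intR j
  intR-* i j = begin
    intR (ℤ.sign i Sign.* ℤ.sign j ◃ ∣ i ∣ ℕ.* ∣ j ∣)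
      ≈⟨ intR-◃ (ℤ.sign i Sign.* ℤ.sign j) (∣ i ∣ ℕ.* ∣ j ∣) ⟩
    signR (ℤ.sign i Sign.* ℤ.sign j) * ((∣ i ∣ ℕ.* ∣ j ∣) × 1#)
      ≈⟨ *-cong (signR-* (ℤ.sign i) (ℤ.sign j)) (×1-homo-* ∣ i ∣ ∣ j ∣) ⟩
    (signR (ℤ.sign i) * signR (ℤ.sign j)) * ((∣ i ∣ × 1#) * (∣ j ∣ × 1#))
      ≈⟨ *-interchange _ _ _ _ ⟩
    (signR (ℤ.sign i) * (∣ i ∣ × 1#)) * (signR (ℤ.sign j) * (∣ j ∣ × 1#))
      ≈⟨ *-cong (intR-signAbs i) (intR-signAbs j) ⟨
    intR i * intR j ∎

  intR-neg : ∀ i → intR (ℤ.- i) ≈ - intR i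
  intR-neg (+ zero)  = sym -0#≈0#
  intR-neg (+ suc n) = refl
  intR-neg -[1+ n ]  = sym (-‿involutive _)

  intR-homomorphism : ℤ.+-*-rawRing ACR.-Raw-AlmostCommutative⟶ ACR.fromCommutativeRing R
  intR-homomorphism = record
    { ⟦_⟧    = intR
    ; +-homo = intR-+
    ; *-homo = intR-*
    ; -‿homo = intR-neg
    ; 0-homo = refl
    ; 1-homo = refl
    }

  open Algebra.Solver.Ring ℤ.+-*-rawRing (ACR.fromCommutativeRing R) intR-homomorphism
    (λ i j → map (reflexive ∘ ≡.cong intR) (dec⇒weaklyDec ℤ._≟_ i j)) public

module FormalPowerSeries {c ℓ : Level} (F : CharZeroField c ℓ) where
  open CharZeroField F
  open import Algebra.Properties.CommutativeSemigroup +-commutativeSemigroup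
    using () renaming (interchange to +-interchange)
  open import Algebra.Properties.CommutativeSemigroup *-commutativeSemigroup
    using (x∙yz≈y∙xz) renaming (interchange to *-interchange)
  open import Relation.Binary.Reasoning.Setoid setoid
  private module K = ℤ-RingSolver cring
  open K using (solve; _:=_; _:+_; _:*_; _:-_)

  ∑ : (ℕ → Carrier) → ℕ → Carrier
  ∑ = sumTo F

  ∑-cong< : ∀ {f g} n → (∀ i → i < n → f i ≈ g i) → ∑ f n ≈ ∑ g n
  ∑-cong< zero    f≈g = refl
  ∑-cong< (suc n) f≈g = +-cong (∑-cong< n (λ i i<n → f≈g i (ℕ.m<n⇒m<1+n i<n))) (f≈g n ℕ.≤-refl)

  ∑-cong : ∀ {f g} n → (∀ i → f i ≈ g i) → ∑ f n ≈ ∑ g n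
  ∑-cong n f≈g = ∑-cong< n (λ i _ → f≈g i)

  ∑-zero< : ∀ {f} n → (∀ i → i < n → f i ≈ 0#) → ∑ f n ≈ 0#
  ∑-zero< zero    f≈0 = refl
  ∑-zero< (suc n) f≈0 = trans (+-cong (∑-zero< n (λ i i<n → f≈0 i (ℕ.m<n⇒m<1+n i<n))) (f≈0 n ℕ.≤-refl))
                              (+-identityˡ _)

  ∑-+ : ∀ f g n → ∑ (λ i → f i + g i) n ≈ ∑ f n + ∑ g n
  ∑-+ f g zero    = sym (+-identityˡ _)
  ∑-+ f g (suc n) = trans (+-congʳ (∑-+ f g n)) (+-interchange _ _ _ _)

  *-distribˡ-∑ : ∀ a f n → a * ∑ f n ≈ ∑ (λ i → a * f i) n
  *-distribˡ-∑ a f zero    = zeroʳ _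
  *-distribˡ-∑ a f (suc n) = trans (distribˡ _ _ _) (+-congʳ (*-distribˡ-∑ a f n))

  *-distribʳ-∑ : ∀ a f n → ∑ f n * a ≈ ∑ (λ i → f i * a) n
  *-distribʳ-∑ a f n = trans (*-comm _ _) (trans (*-distribˡ-∑ a f n) (∑-cong n (λ i → *-comm _ _)))

  ∑-head : ∀ f n → ∑ f (suc n) ≈ f 0 + ∑ (λ i → f (suc i)) n
  ∑-head f zero    = +-comm _ _
  ∑-head f (suc n) = trans (+-congʳ (∑-head f n)) (+-assoc _ _ _)

  ∑-reverse : ∀ f n → ∑ f (suc n) ≈ ∑ (λ i → f (n ∸ i)) (suc n)
  ∑-reverse f zero    = refl
  ∑-reverse f (suc n) = sym (begin
    ∑ (λ i → f (suc n ∸ i)) (suc (suc n))  ≈⟨ ∑-head _ (suc n) ⟩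
    f (suc n) + ∑ (λ i → f (n ∸ i)) (suc n) ≈⟨ +-congˡ (∑-reverse f n) ⟨
    f (suc n) + ∑ f (suc n)                 ≈⟨ +-comm _ _ ⟩
    ∑ f (suc (suc n))                       ∎)

  ∑-+zeros : ∀ f n m → (∀ i → n ≤ i → f i ≈ 0#) → ∑ f (n ℕ.+ m) ≈ ∑ f n
  ∑-+zeros f n zero    f≈0 = reflexive (≡.cong (∑ f) (ℕ.+-identityʳ n))
  ∑-+zeros f n (suc m) f≈0 = begin
    ∑ f (n ℕ.+ suc m)           ≡⟨ ≡.cong (∑ f) (ℕ.+-suc n m) ⟩
    ∑ f (n ℕ.+ m) + f (n ℕ.+ m) ≈⟨ +-cong (∑-+zeros f n m f≈0) (f≈0 _ (ℕ.m≤m+n n m)) ⟩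
    ∑ f n + 0#                  ≈⟨ +-identityʳ _ ⟩
    ∑ f n                       ∎

  ∑-pad : ∀ f {n M} → n ≤ M → (∀ i → n ≤ i → f i ≈ 0#) → ∑ f M ≈ ∑ f n
  ∑-pad f {n} {M} n≤M f≈0 =
    trans (reflexive (≡.cong (∑ f) (≡.sym (ℕ.m+[n∸m]≡n n≤M)))) (∑-+zeros f n (M ∸ n) f≈0)

  ∑-swap : ∀ (A : ℕ → ℕ → Carrier) M N →
    ∑ (λ i → ∑ (λ j → A i j) N) M ≈ ∑ (λ j → ∑ (λ i → A i j) M) N
  ∑-swap A zero    N = sym (∑-zero< N (λ _ _ → refl))
  ∑-swap A (suc M) N = trans (+-congʳ (∑-swap A M N)) (sym (∑-+ _ _ N))

  infix  4 _≋_
  infixl 6 _+ₛ_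
  infixl 7 _*ₛ_ _·ₛ_

  _≋_ : Series F → Series F → Set ℓ
  f ≋ g = ∀ n → f n ≈ g n

  _+ₛ_ : Series F → Series F → Series F
  (f +ₛ g) n = f n + g n

  -ₛ_ : Series F → Series F
  (-ₛ f) n = - f n

  0ₛ : Series F
  0ₛ _ = 0#

  1ₛ : Series F
  1ₛ = oneS F

  _*ₛ_ : Series F → Series F → Series F
  _*ₛ_ = mulS F

  _·ₛ_ : Carrier → Series F → Series F
  (a ·ₛ f) n = a * f n

  *ₛ-cong : ∀ {f f′ g g′} → f ≋ f′ → g ≋ g′ → f *ₛ g ≋ f′ *ₛ g′
  *ₛ-cong f≋f′ g≋g′ n = ∑-cong (suc n) (λ i → *-cong (f≋f′ i) (g≋g′ (n ∸ i)))

  *ₛ-coeff-0 : ∀ f g → (f *ₛ g) 0 ≈ f 0 * g 0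
  *ₛ-coeff-0 f g = +-identityˡ _

  *ₛ-coeff-suc : ∀ f g n → (f *ₛ g) (suc n) ≈ f 0 * g (suc n) + ((λ i → f (suc i)) *ₛ g) n
  *ₛ-coeff-suc f g n = ∑-head (λ i → f i * g (suc n ∸ i)) (suc n)

  *ₛ-comm : ∀ f g → f *ₛ g ≋ g *ₛ f
  *ₛ-comm f g n = trans (∑-reverse (λ i → f i * g (n ∸ i)) n) (∑-cong< (suc n) λ i i≤n →
    trans (*-comm _ _) (*-congʳ (reflexive (≡.cong g (ℕ.m∸[m∸n]≡n (ℕ.≤-pred i≤n))))))

  *ₛ-distribʳ : ∀ f g h → (f +ₛ g) *ₛ h ≋ f *ₛ h +ₛ g *ₛ h
  *ₛ-distribʳ f g h n = trans (∑-cong (suc n) (λ i → distribʳ _ _ _)) (∑-+ _ _ (suc n))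

  ·ₛ-*ₛ : ∀ a f g → (a ·ₛ f) *ₛ g ≋ a ·ₛ (f *ₛ g)
  ·ₛ-*ₛ a f g n = trans (∑-cong (suc n) (λ i → *-assoc _ _ _)) (sym (*-distribˡ-∑ a _ (suc n)))

  *ₛ-assoc : ∀ f g h → (f *ₛ g) *ₛ h ≋ f *ₛ (g *ₛ h)
  *ₛ-assoc f g h zero = begin
    ((f *ₛ g) *ₛ h) 0  ≈⟨ trans (*ₛ-coeff-0 (f *ₛ g) h) (*-congʳ (*ₛ-coeff-0 f g)) ⟩
    (f 0 * g 0) * h 0  ≈⟨ *-assoc _ _ _ ⟩
    f 0 * (g 0 * h 0)  ≈⟨ trans (*ₛ-coeff-0 f (g *ₛ h)) (*-congˡ (*ₛ-coeff-0 g h)) ⟨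
    (f *ₛ (g *ₛ h)) 0  ∎
  *ₛ-assoc f g h (suc n) = begin
    ((f *ₛ g) *ₛ h) (suc n)
      ≈⟨ *ₛ-coeff-suc (f *ₛ g) h n ⟩
    (f *ₛ g) 0 * h (suc n) + (tail (f *ₛ g) *ₛ h) n
      ≈⟨ +-cong (*-congʳ (*ₛ-coeff-0 f g)) (*ₛ-cong {g = h} (*ₛ-coeff-suc f g) (λ _ → refl) n) ⟩
    (f 0 * g 0) * h (suc n) + ((f 0 ·ₛ tail g +ₛ tail f *ₛ g) *ₛ h) n
      ≈⟨ +-congˡ (trans (*ₛ-distribʳ (f 0 ·ₛ tail g) (tail f *ₛ g) h n)
                        (+-cong (·ₛ-*ₛ (f 0) (tail g) h n) (*ₛ-assoc (tail f) g h n))) ⟩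
    (f 0 * g 0) * h (suc n) + (f 0 * (tail g *ₛ h) n + (tail f *ₛ (g *ₛ h)) n)
      ≈⟨ solve 5 (λ a b c d e → (a :* b) :* c :+ (a :* d :+ e) := a :* (b :* c :+ d) :+ e) refl _ _ _ _ _ ⟩
    f 0 * (g 0 * h (suc n) + (tail g *ₛ h) n) + (tail f *ₛ (g *ₛ h)) n
      ≈⟨ +-congʳ (*-congˡ (*ₛ-coeff-suc g h n)) ⟨
    f 0 * (g *ₛ h) (suc n) + (tail f *ₛ (g *ₛ h)) n
      ≈⟨ *ₛ-coeff-suc f (g *ₛ h) n ⟨
    (f *ₛ (g *ₛ h)) (suc n) ∎
    where
    tail : Series F → Series F
    tail u i = u (suc i)

  *ₛ-zero : ∀ {f} g → f ≋ 0ₛ → f *ₛ g ≋ 0ₛ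
  *ₛ-zero g f≋0 n = ∑-zero< (suc n) (λ i _ → trans (*-congʳ (f≋0 i)) (zeroˡ _))

  *ₛ-identityˡ : ∀ f → 1ₛ *ₛ f ≋ f
  *ₛ-identityˡ f zero    = trans (*ₛ-coeff-0 1ₛ f) (*-identityˡ _)
  *ₛ-identityˡ f (suc n) = trans (*ₛ-coeff-suc 1ₛ f n)
    (trans (+-cong (*-identityˡ _) (*ₛ-zero f (λ _ → refl) n)) (+-identityʳ _))

  seriesRing : CommutativeRing c ℓ
  seriesRing = record
    { Carrier           = Series F
    ; _≈_               = _≋_
    ; _+_               = _+ₛ_
    ; _*_               = _*ₛ_
    ; -_                = -ₛ_
    ; 0#                = 0ₛ
    ; 1#                = 1ₛ
    ; isCommutativeRing = record
      { isRing = record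
        { +-isAbelianGroup = record
          { isGroup = record
            { isMonoid = record
              { isSemigroup = record
                { isMagma = record
                  { isEquivalence = record
                    { refl  = λ _ → refl
                    ; sym   = λ f≋g n → sym (f≋g n)
                    ; trans = λ f≋g g≋h n → trans (f≋g n) (g≋h n)
                    }
                  ; ∙-cong = λ f≋f′ g≋g′ n → +-cong (f≋f′ n) (g≋g′ n)
                  }
                ; assoc = λ _ _ _ _ → +-assoc _ _ _
                }
              ; identity = (λ _ _ → +-identityˡ _) , (λ _ _ → +-identityʳ _)
              }
            ; inverse = (λ _ _ → -‿inverseˡ _) , (λ _ _ → -‿inverseʳ _)
            ; ⁻¹-cong = λ f≋g n → -‿cong (f≋g n)
            }
          ; comm = λ _ _ _ → +-comm _ _
          }
        ; *-cong     = *ₛ-cong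
        ; *-assoc    = *ₛ-assoc
        ; *-identity = *ₛ-identityˡ , (λ f n → trans (*ₛ-comm f 1ₛ n) (*ₛ-identityˡ f n))
        ; distrib    = (λ f g h n → trans (*ₛ-comm f (g +ₛ h) n)
                                      (trans (*ₛ-distribʳ g h f n) (+-cong (*ₛ-comm g f n) (*ₛ-comm h f n))))
                     , (λ f g h → *ₛ-distribʳ g h f)
        }
      ; *-comm = *ₛ-comm
      }
    }

  private module S = ℤ-RingSolver seriesRing
  open import Algebra.Properties.Semiring.Mult.TCOptimised (CommutativeRing.semiring seriesRing)
    using () renaming (_×_ to _×ₛ_; 1+× to 1+×ₛ)
  open CommutativeRing seriesRing public using () renaming
    ( refl to ≋-refl; sym to ≋-sym; trans to ≋-trans; setoid to ≋-setoid
    ; +-cong to +ₛ-cong; *-identityʳ to *ₛ-identityʳ )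

  ∂ : Series F → Series F
  ∂ f n = natC (suc n) * f (suc n)

  ∂-cong : ∀ {f g} → f ≋ g → ∂ f ≋ ∂ g
  ∂-cong f≋g n = *-congˡ (f≋g (suc n))

  ∂-1ₛ : ∂ 1ₛ ≋ 0ₛ
  ∂-1ₛ n = zeroʳ _

  ∂-*ₛ : ∀ f g → ∂ (f *ₛ g) ≋ ∂ f *ₛ g +ₛ f *ₛ ∂ g
  ∂-*ₛ f g n = begin
    natC (suc n) * (f *ₛ g) (suc n)                            ≈⟨ *-distribˡ-∑ _ T (suc (suc n)) ⟩
    ∑ (λ i → natC (suc n) * T i) (suc (suc n))                 ≈⟨ ∑-cong< (suc (suc n)) split ⟩
    ∑ (λ i → natC i * T i + natC (suc n ∸ i) * T i) (suc (suc n)) ≈⟨ ∑-+ _ _ (suc (suc n)) ⟩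
    ∑ (λ i → natC i * T i) (suc (suc n)) + ∑ (λ i → natC (suc n ∸ i) * T i) (suc (suc n))
                                                               ≈⟨ +-cong left right ⟩
    (∂ f *ₛ g) n + (f *ₛ ∂ g) n                                ∎
    where
    T : ℕ → Carrier
    T i = f i * g (suc n ∸ i)
    split : ∀ i → i < suc (suc n) → natC (suc n) * T i ≈ natC i * T i + natC (suc n ∸ i) * T i
    split i i<2+n = trans (*-congʳ (trans (reflexive (≡.cong natC (≡.sym (ℕ.m+[n∸m]≡n (ℕ.≤-pred i<2+n)))))
                                          (K.natR-+ i (suc n ∸ i))))
                          (distribʳ _ _ _)
    left : ∑ (λ i → natC i * T i) (suc (suc n)) ≈ (∂ f *ₛ g) n
    left = begin
      ∑ (λ i → natC i * T i) (suc (suc n))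
        ≈⟨ ∑-head _ (suc n) ⟩
      0# * T 0 + ∑ (λ i → natC (suc i) * T (suc i)) (suc n)
        ≈⟨ +-cong (zeroˡ _) (∑-cong (suc n) (λ i → sym (*-assoc _ _ _))) ⟩
      0# + (∂ f *ₛ g) n
        ≈⟨ +-identityˡ _ ⟩
      (∂ f *ₛ g) n
        ∎
    right : ∑ (λ i → natC (suc n ∸ i) * T i) (suc (suc n)) ≈ (f *ₛ ∂ g) n
    right = begin
      ∑ (λ i → natC (suc n ∸ i) * T i) (suc n) + natC (suc n ∸ suc n) * T (suc n)
        ≈⟨ +-cong (∑-cong< (suc n) reorder) (trans (*-congʳ (reflexive (≡.cong natC (ℕ.n∸n≡0 n)))) (zeroˡ _)) ⟩
      (f *ₛ ∂ g) n + 0# ≈⟨ +-identityʳ _ ⟩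
      (f *ₛ ∂ g) n      ∎
      where
      reorder : ∀ i → i < suc n → natC (suc n ∸ i) * T i ≈ f i * ∂ g (n ∸ i)
      reorder i i<1+n rewrite ℕ.+-∸-assoc 1 (ℕ.≤-pred i<1+n) =
        x∙yz≈y∙xz _ _ _

  ×ₛ1ₛ-*ₛ : ∀ m g → (m ×ₛ 1ₛ) *ₛ g ≋ natC m ·ₛ g
  ×ₛ1ₛ-*ₛ zero    g n = trans (*ₛ-zero g (λ _ → refl) n) (sym (zeroˡ _))
  ×ₛ1ₛ-*ₛ (suc m) g n = begin
    ((suc m ×ₛ 1ₛ) *ₛ g) n          ≈⟨ *ₛ-cong {g = g} (1+×ₛ m 1ₛ) (λ _ → refl) n ⟩
    ((1ₛ +ₛ m ×ₛ 1ₛ) *ₛ g) n        ≈⟨ *ₛ-distribʳ 1ₛ (m ×ₛ 1ₛ) g n ⟩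
    (1ₛ *ₛ g) n + ((m ×ₛ 1ₛ) *ₛ g) n ≈⟨ +-cong (*ₛ-identityˡ g n) (×ₛ1ₛ-*ₛ m g n) ⟩
    g n + natC m * g n              ≈⟨ +-congʳ (*-identityˡ _) ⟨
    1# * g n + natC m * g n         ≈⟨ distribʳ _ _ _ ⟨
    natC (suc m) * g n              ∎

  _^ₛ_ : Series F → ℕ → Series F
  _^ₛ_ = powS F

  ∂-^ₛ : ∀ s j → ∂ (s ^ₛ suc j) ≋ (suc j ×ₛ 1ₛ) *ₛ (s ^ₛ j *ₛ ∂ s)
  ∂-^ₛ s zero = ≋-trans (∂-*ₛ s 1ₛ) (≋-trans (+ₛ-cong ≋-refl (*ₛ-cong {f = s} ≋-refl ∂-1ₛ))
    (S.solve 2 (λ s ds → ds S.:* S.con 1ℤ S.:+ s S.:* S.con 0ℤ S.:= S.con 1ℤ S.:* (S.con 1ℤ S.:* ds))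
      ≋-refl s (∂ s)))
  ∂-^ₛ s (suc j) = ≋-trans (∂-*ₛ s (s ^ₛ suc j))
    (≋-trans (+ₛ-cong ≋-refl (*ₛ-cong {f = s} ≋-refl (∂-^ₛ s j)))
    (S.solve 4 (λ ds s q N → ds S.:* (s S.:* q) S.:+ s S.:* (N S.:* (q S.:* ds))
                             S.:= (N S.:+ S.con 1ℤ) S.:* ((s S.:* q) S.:* ds))
      ≋-refl (∂ s) s (s ^ₛ j) (suc j ×ₛ 1ₛ)))

  *ₛ-vanishes-below : ∀ s g n → s 0 ≈ 0# → (∀ m → m < n → g m ≈ 0#) → (s *ₛ g) n ≈ 0#
  *ₛ-vanishes-below s g n s₀≈0 g≈0 = ∑-zero< (suc n) term≈0
    where
    term≈0 : ∀ i → i < suc n → s i * g (n ∸ i) ≈ 0#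
    term≈0 zero    _       = trans (*-congʳ s₀≈0) (zeroˡ _)
    term≈0 (suc i) i<1+n = trans (*-congˡ (g≈0 _ (ℕ.∸-monoʳ-< (s≤s z≤n) (ℕ.≤-pred i<1+n)))) (zeroʳ _)

  ^ₛ-vanishes-below : ∀ s → s 0 ≈ 0# → ∀ j n → n < j → (s ^ₛ j) n ≈ 0#
  ^ₛ-vanishes-below s s₀≈0 (suc j) n n<1+j = *ₛ-vanishes-below s (s ^ₛ j) n s₀≈0
    (λ m m<n → ^ₛ-vanishes-below s s₀≈0 j m (ℕ.<-≤-trans m<n (ℕ.≤-pred n<1+j)))

  _∘ₛ_ : Series F → Series F → Series F
  _∘ₛ_ = compS F

  ∘ₛ-coeff-pad : ∀ c s → s 0 ≈ 0# → ∀ {n M} → n < M → (c ∘ₛ s) n ≈ ∑ (λ j → c j * (s ^ₛ j) n) M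
  ∘ₛ-coeff-pad c s s₀≈0 n<M = sym (∑-pad _ n<M
    (λ j n<j → trans (*-congˡ (^ₛ-vanishes-below s s₀≈0 j _ n<j)) (zeroʳ _)))

  ∘ₛ-cong : ∀ {c c′} s → c ≋ c′ → c ∘ₛ s ≋ c′ ∘ₛ s
  ∘ₛ-cong s c≋c′ n = ∑-cong (suc n) (λ j → *-congʳ (c≋c′ j))

  ∘ₛ-+ₛ : ∀ c d s → (c +ₛ d) ∘ₛ s ≋ c ∘ₛ s +ₛ d ∘ₛ s
  ∘ₛ-+ₛ c d s n = trans (∑-cong (suc n) (λ j → distribʳ _ _ _)) (∑-+ _ _ (suc n))

  ∘ₛ-coeff-0 : ∀ c s → (c ∘ₛ s) 0 ≈ c 0
  ∘ₛ-coeff-0 c s = trans (+-identityˡ _) (*-identityʳ _)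

  1ₛ-∘ₛ : ∀ s → 1ₛ ∘ₛ s ≋ 1ₛ
  1ₛ-∘ₛ s n = trans (∑-head _ n) (trans (+-cong (*-identityˡ _) (∑-zero< n (λ i _ → zeroˡ _))) (+-identityʳ _))

  ∂-∘ₛ : ∀ c s → s 0 ≈ 0# → ∂ (c ∘ₛ s) ≋ (∂ c ∘ₛ s) *ₛ ∂ s
  ∂-∘ₛ c s s₀≈0 n = begin
    natC (suc n) * (c ∘ₛ s) (suc n)
      ≈⟨ *-distribˡ-∑ _ _ (suc (suc n)) ⟩
    ∑ (λ j → natC (suc n) * (c j * (s ^ₛ j) (suc n))) (suc (suc n))
      ≈⟨ ∑-cong (suc (suc n)) (λ j → x∙yz≈y∙xz _ _ _) ⟩
    ∑ (λ j → c j * ∂ (s ^ₛ j) n) (suc (suc n))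
      ≈⟨ ∑-head _ (suc n) ⟩
    c 0 * ∂ 1ₛ n + ∑ (λ j → c (suc j) * ∂ (s ^ₛ suc j) n) (suc n)
      ≈⟨ +-cong (trans (*-congˡ (∂-1ₛ n)) (zeroʳ _)) (∑-cong (suc n) power-rule) ⟩
    0# + ∑ (λ j → ∂ c j * (s ^ₛ j *ₛ ∂ s) n) (suc n)
      ≈⟨ trans (+-identityˡ _) (∑-cong (suc n) (λ j → *-distribˡ-∑ _ _ (suc n))) ⟩
    ∑ (λ j → ∑ (λ i → ∂ c j * ((s ^ₛ j) i * ∂ s (n ∸ i))) (suc n)) (suc n)
      ≈⟨ ∑-swap _ (suc n) (suc n) ⟨
    ∑ (λ i → ∑ (λ j → ∂ c j * ((s ^ₛ j) i * ∂ s (n ∸ i))) (suc n)) (suc n)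
      ≈⟨ ∑-cong (suc n) (λ i → trans (∑-cong (suc n) (λ j → sym (*-assoc _ _ _)))
                                      (sym (*-distribʳ-∑ _ _ (suc n)))) ⟩
    ∑ (λ i → ∑ (λ j → ∂ c j * (s ^ₛ j) i) (suc n) * ∂ s (n ∸ i)) (suc n)
      ≈⟨ ∑-cong< (suc n) (λ i i<1+n → *-congʳ (∘ₛ-coeff-pad (∂ c) s s₀≈0 i<1+n)) ⟨
    ((∂ c ∘ₛ s) *ₛ ∂ s) n
      ∎
    where
    power-rule : ∀ j → c (suc j) * ∂ (s ^ₛ suc j) n ≈ ∂ c j * (s ^ₛ j *ₛ ∂ s) n
    power-rule j = trans (*-congˡ (trans (∂-^ₛ s j n) (×ₛ1ₛ-*ₛ (suc j) (s ^ₛ j *ₛ ∂ s) n)))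
      (solve 3 (λ x y z → x :* (y :* z) := (y :* x) :* z) refl _ _ _)

  t·_ : Series F → Series F
  (t· c) zero    = 0#
  (t· c) (suc j) = c j

  t·-∂ : ∀ c j → (t· ∂ c) j ≈ natC j * c j
  t·-∂ c zero    = sym (zeroˡ _)
  t·-∂ c (suc j) = refl

  *ₛ-by-linear : ∀ f g → (∀ i → f (suc (suc i)) ≈ 0#) → ∀ n → (f *ₛ g) n ≈ f 0 * g n + f 1 * (t· g) n
  *ₛ-by-linear f g f≈0 zero    = trans (*ₛ-coeff-0 f g) (sym (trans (+-congˡ (zeroʳ _)) (+-identityʳ _)))
  *ₛ-by-linear f g f≈0 (suc n) = trans (*ₛ-coeff-suc f g n) (+-congˡ (begin
    ∑ (λ i → f (suc i) * g (n ∸ i)) (suc n)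
      ≈⟨ ∑-head _ n ⟩
    f 1 * g n + ∑ (λ i → f (suc (suc i)) * g (n ∸ suc i)) n
      ≈⟨ +-congˡ (∑-zero< n (λ i _ → trans (*-congʳ (f≈0 i)) (zeroˡ _))) ⟩
    f 1 * g n + 0#
      ≈⟨ +-identityʳ _ ⟩
    f 1 * g n
      ∎))

  tₛ : Series F
  tₛ = t· 1ₛ

  tₛ-*ₛ : ∀ g → tₛ *ₛ g ≋ t· g
  tₛ-*ₛ g n = trans (*ₛ-by-linear tₛ g (λ _ → refl) n) (trans (+-cong (zeroˡ _) (*-identityˡ _)) (+-identityˡ _))

  ∘ₛ-*ₛ-inner : ∀ c s → s 0 ≈ 0# → (c ∘ₛ s) *ₛ s ≋ (t· c) ∘ₛ s
  ∘ₛ-*ₛ-inner c s s₀≈0 n = begin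
    ((c ∘ₛ s) *ₛ s) n
      ≈⟨ *ₛ-comm (c ∘ₛ s) s n ⟩
    ∑ (λ i → s i * (c ∘ₛ s) (n ∸ i)) (suc n)
      ≈⟨ ∑-cong (suc n) (λ i → *-congˡ (∘ₛ-coeff-pad c s s₀≈0 (s≤s (ℕ.m∸n≤m n i)))) ⟩
    ∑ (λ i → s i * ∑ (λ j → c j * (s ^ₛ j) (n ∸ i)) (suc n)) (suc n)
      ≈⟨ ∑-cong (suc n) (λ i → trans (*-distribˡ-∑ _ _ (suc n)) (∑-cong (suc n) (λ j →
           x∙yz≈y∙xz _ _ _))) ⟩
    ∑ (λ i → ∑ (λ j → c j * (s i * (s ^ₛ j) (n ∸ i))) (suc n)) (suc n)
      ≈⟨ ∑-swap _ (suc n) (suc n) ⟩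
    ∑ (λ j → ∑ (λ i → c j * (s i * (s ^ₛ j) (n ∸ i))) (suc n)) (suc n)
      ≈⟨ ∑-cong (suc n) (λ j → sym (*-distribˡ-∑ _ _ (suc n))) ⟩
    ∑ (λ j → c j * (s ^ₛ suc j) n) n + c n * (s ^ₛ suc n) n
      ≈⟨ +-congˡ (trans (*-congˡ (^ₛ-vanishes-below s s₀≈0 (suc n) n ℕ.≤-refl)) (zeroʳ _)) ⟩
    ∑ (λ j → c j * (s ^ₛ suc j) n) n + 0#
      ≈⟨ trans (+-identityʳ _) (sym (+-identityˡ _)) ⟩
    0# + ∑ (λ j → c j * (s ^ₛ suc j) n) n
      ≈⟨ +-congʳ (zeroˡ _) ⟨
    0# * (s ^ₛ 0) n + ∑ (λ j → c j * (s ^ₛ suc j) n) n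
      ≈⟨ ∑-head _ n ⟨
    ((t· c) ∘ₛ s) n
      ∎

  cst : Carrier → Series F
  cst a zero    = a
  cst a (suc _) = 0#

  cst-*ₛ : ∀ a f → cst a *ₛ f ≋ a ·ₛ f
  cst-*ₛ a f zero    = *ₛ-coeff-0 (cst a) f
  cst-*ₛ a f (suc n) = trans (*ₛ-by-linear (cst a) f (λ _ → refl) (suc n)) (trans (+-congˡ (zeroˡ _)) (+-identityʳ _))

  cst-* : ∀ a b → cst (a * b) ≋ cst a *ₛ cst b
  cst-* a b n = sym (trans (cst-*ₛ a (cst b) n) (lemma n))
    where
    lemma : ∀ n → a * cst b n ≈ cst (a * b) n
    lemma zero    = refl
    lemma (suc n) = zeroʳ _

  invN-cancel : ∀ n y → invN F n * (natC (suc n) * y) ≈ y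
  invN-cancel n y = trans (sym (*-assoc _ _ _))
    (trans (*-congʳ (trans (*-comm _ _) (inv-r _ (charZero n)))) (*-identityˡ _))

  module _ (P : Series F) (γ : Carrier) (P₀≈1 : P 0 ≈ 1#) (P-linear : ∀ i → P (suc (suc i)) ≈ 0#) where

    linear-ODE-recurrence : ∀ G → P *ₛ ∂ G ≋ cst γ *ₛ G →
      ∀ n → natC (suc n) * G (suc n) ≈ γ * G n - P 1 * (natC n * G n)
    linear-ODE-recurrence G ode n = begin
      natC (suc n) * G (suc n)
        ≈⟨ solve 2 (λ x y → x := (x :+ y) :- y) refl _ _ ⟩
      (natC (suc n) * G (suc n) + P 1 * (natC n * G n)) - P 1 * (natC n * G n)
        ≈⟨ +-congʳ (+-cong (trans (*-congʳ P₀≈1) (*-identityˡ _)) (*-congˡ (t·-∂ G n))) ⟨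
      (P 0 * ∂ G n + P 1 * (t· ∂ G) n) - P 1 * (natC n * G n)
        ≈⟨ +-congʳ (trans (sym (*ₛ-by-linear P (∂ G) P-linear n)) (trans (ode n) (cst-*ₛ γ G n))) ⟩
      γ * G n - P 1 * (natC n * G n)
        ∎

    linear-ODE-unique : ∀ G H → P *ₛ ∂ G ≋ cst γ *ₛ G → P *ₛ ∂ H ≋ cst γ *ₛ H → G 0 ≈ H 0 → G ≋ H
    linear-ODE-unique G H odeG odeH G₀≈H₀ zero    = G₀≈H₀
    linear-ODE-unique G H odeG odeH G₀≈H₀ (suc n) = begin
      G (suc n)                                     ≈⟨ invN-cancel n _ ⟨
      invN F n * (natC (suc n) * G (suc n))          ≈⟨ *-congˡ (linear-ODE-recurrence G odeG n) ⟩
      invN F n * (γ * G n - P 1 * (natC n * G n))    ≈⟨ *-congˡ (+-cong (*-congˡ Gₙ≈Hₙ)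
                                                                (-‿cong (*-congˡ (*-congˡ Gₙ≈Hₙ)))) ⟩
      invN F n * (γ * H n - P 1 * (natC n * H n))    ≈⟨ *-congˡ (linear-ODE-recurrence H odeH n) ⟨
      invN F n * (natC (suc n) * H (suc n))          ≈⟨ invN-cancel n _ ⟩
      H (suc n)                                     ∎
      where
      Gₙ≈Hₙ : G n ≈ H n
      Gₙ≈Hₙ = linear-ODE-unique G H odeG odeH G₀≈H₀ n

  pw-+ : ∀ b i j → pw F b (i ℕ.+ j) ≈ pw F b i * pw F b j
  pw-+ b zero    j = sym (*-identityˡ _)
  pw-+ b (suc i) j = trans (*-congˡ (pw-+ b i j)) (sym (*-assoc _ _ _))

  dilate : Carrier → Series F → Series F
  dilate b f n = pw F b n * f n

  dilate-cong : ∀ b {f g} → f ≋ g → dilate b f ≋ dilate b g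
  dilate-cong b f≋g n = *-congˡ (f≋g n)

  dilate-1ₛ : ∀ b → dilate b 1ₛ ≋ 1ₛ
  dilate-1ₛ b zero    = *-identityʳ _
  dilate-1ₛ b (suc n) = zeroʳ _

  dilate-*ₛ : ∀ b f g → dilate b (f *ₛ g) ≋ dilate b f *ₛ dilate b g
  dilate-*ₛ b f g n = trans (*-distribˡ-∑ _ _ (suc n)) (∑-cong< (suc n) distribute)
    where
    distribute : ∀ i → i < suc n → pw F b n * (f i * g (n ∸ i)) ≈ dilate b f i * dilate b g (n ∸ i)
    distribute i i<1+n = trans
      (*-congʳ (trans (reflexive (≡.cong (pw F b) (≡.sym (ℕ.m+[n∸m]≡n (ℕ.≤-pred i<1+n))))) (pw-+ b i (n ∸ i))))
      (*-interchange _ _ _ _)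

  geometric : Series F
  geometric _ = 1#

  geometric-∘ₛ-inverse : ∀ w → w 0 ≈ 0# → (geometric ∘ₛ w) *ₛ (1ₛ +ₛ -ₛ w) ≋ 1ₛ
  geometric-∘ₛ-inverse w w₀≈0 =
    ≋-trans (S.solve 2 (λ A w → A S.:* (S.con 1ℤ S.:- w) S.:= A S.:- A S.:* w) ≋-refl A w)
   (≋-trans (+ₛ-cong A≋1+A*w ≋-refl)
            (S.solve 2 (λ A w → (S.con 1ℤ S.:+ A S.:* w) S.:- A S.:* w S.:= S.con 1ℤ) ≋-refl A w))
    where
    A : Series F
    A = geometric ∘ₛ w
    geometric-unfold : geometric ≋ 1ₛ +ₛ t· geometric
    geometric-unfold zero    = sym (+-identityʳ _)
    geometric-unfold (suc n) = sym (+-identityˡ _)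
    A≋1+A*w : A ≋ 1ₛ +ₛ A *ₛ w
    A≋1+A*w = ≋-trans (∘ₛ-cong w geometric-unfold) (≋-trans (∘ₛ-+ₛ 1ₛ (t· geometric) w)
                (+ₛ-cong (1ₛ-∘ₛ w) (≋-sym (∘ₛ-*ₛ-inner geometric w w₀≈0))))

nCk*[k!*[n∸k]!]≡n! : ∀ {n k} → k ≤ n → (n C k) ℕ.* (k ! ℕ.* (n ∸ k) !) ≡ n !
nCk*[k!*[n∸k]!]≡n! {n} {k} k≤n = ≡.trans (≡.cong (ℕ._* (k ! ℕ.* (n ∸ k) !)) (nCk≡n!/k![n-k]! k≤n))
                                          (m/n*n≡m (k![n∸k]!∣n! k≤n))
  where instance _ = k ℕ.!* (n ∸ k) !≢0

module PC-Recurrence {c ℓ : Level} (F : CharZeroField c ℓ)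
  (a : CharZeroField.Carrier F) (a≉0 : ¬ (CharZeroField._≈_ F a (CharZeroField.0# F))) where

  open CharZeroField F
  open FormalPowerSeries F
  private
    module K = ℤ-RingSolver cring
    module S = ℤ-RingSolver seriesRing
  open K using (solve; _:=_; _:+_; _:*_; _:-_; :-_; con)
  open import Algebra.Properties.Ring ring using (-0#≈0#; -‿+-comm)
  open import Algebra.Properties.CommutativeSemigroup *-commutativeSemigroup using (x∙yz≈y∙xz)

  -- In the notation of the header: α = 1/a, P = 1+u, R = 1/(1+u), Ĉ = Ĉ(u), and Λ′ k = Lif_k′(L).
  α : Carrier
  α = ainv F a a≉0

  L : Series F
  L = logA F a a≉0

  L/t : Series F
  L/t n = L (suc n)

  P : Series F
  P = dilate α (onePlusT F)

  R : Series F
  R n = sign F n * pw F α n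

  Ĉ : Series F
  Ĉ = dilate α (invQ F)

  E : Carrier → Series F
  E x = expCoeff F ∘ₛ powX F a a≉0 x

  Λ Λ′ : ℤ → Series F
  Λ  k = lifCoeff F k ∘ₛ L
  Λ′ k = ∂ (lifCoeff F k) ∘ₛ L

  G : ℤ → Carrier → Series F
  G = genPC F a a≉0

  Y : ℤ → Carrier → Series F
  Y k x = expNeg F *ₛ ((Λ′ k *ₛ L/t) *ₛ E x)

  module _ where
    open import Relation.Binary.Reasoning.Setoid setoid

    natC*invN : ∀ n → natC (suc n) * invN F n ≈ 1#
    natC*invN n = inv-r _ (charZero n)

    invN-0 : invN F 0 ≈ 1#
    invN-0 = trans (sym (*-identityˡ _)) (trans (*-congʳ (sym (+-identityʳ 1#))) (natC*invN 0))

    lifCoeff-pred : ∀ k j → lifCoeff F (k -ℤ 1ℤ) j ≈ natC (suc j) * lifCoeff F k j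
    lifCoeff-pred (+ zero) j = solve 2 (λ f n → f :* (n :* con 1ℤ) := n :* (f :* con 1ℤ)) refl _ _
    lifCoeff-pred (+ suc m) j = begin
      invFact F j * pw F (invN F j) m
        ≈⟨ trans (sym (*-identityˡ _)) (*-congʳ (sym (natC*invN j))) ⟩
      (natC (suc j) * invN F j) * (invFact F j * pw F (invN F j) m)
        ≈⟨ solve 4 (λ n i f p → (n :* i) :* (f :* p) := n :* (f :* (i :* p))) refl _ _ _ _ ⟩
      natC (suc j) * (invFact F j * pw F (invN F j) (suc m))
        ∎
    lifCoeff-pred -[1+ m ] j rewrite ℕ.+-identityʳ m =
      x∙yz≈y∙xz _ _ _

    ∂-expNeg : ∂ (expNeg F) ≋ -ₛ expNeg F
    ∂-expNeg n = trans
      (solve 4 (λ N I s f → N :* ((:- con 1ℤ :* s) :* (I :* f)) := (N :* I) :* (:- (s :* f))) refl _ _ _ _)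
      (trans (*-congʳ (natC*invN n)) (*-identityˡ _))

    ∂-expCoeff : ∂ (expCoeff F) ≋ expCoeff F
    ∂-expCoeff n = trans (sym (*-assoc _ _ _)) (trans (*-congʳ (natC*invN n)) (*-identityˡ _))

    ∂-L : ∂ L ≋ cst α *ₛ R
    ∂-L n = trans
      (solve 5 (λ N I s x p → N :* ((s :* (x :* p)) :* I) := (N :* I) :* (x :* (s :* p))) refl _ _ _ _ _)
      (trans (*-congʳ (natC*invN n)) (trans (*-identityˡ _) (sym (cst-*ₛ α R n))))

    ∂-powX : ∀ x → ∂ (powX F a a≉0 x) ≋ cst (- x) *ₛ ∂ L
    ∂-powX x n = trans (x∙yz≈y∙xz _ _ _)
                       (sym (cst-*ₛ (- x) (∂ L) n))

    L/t≈α*dilated-logOverT : L/t ≋ cst α *ₛ dilate α (logOverT F)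
    L/t≈α*dilated-logOverT n = trans
      (solve 4 (λ I s x p → (s :* (x :* p)) :* I := x :* (p :* (s :* I))) refl _ _ _ _)
      (sym (cst-*ₛ α (dilate α (logOverT F)) n))

    L≈t*L/t : L ≋ tₛ *ₛ L/t
    L≈t*L/t n = trans (L≈t·L/t n) (sym (tₛ-*ₛ L/t n))
      where
      L≈t·L/t : L ≋ t· L/t
      L≈t·L/t zero    = refl
      L≈t·L/t (suc n) = refl

    P₀≈1 : P 0 ≈ 1#
    P₀≈1 = *-identityˡ _

    P-linear : ∀ i → P (suc (suc i)) ≈ 0#
    P-linear i = zeroʳ _

    P*R≈1 : P *ₛ R ≋ 1ₛ
    P*R≈1 n = trans (*ₛ-by-linear P R P-linear n) (telescope n)
      where
      telescope : ∀ n → P 0 * R n + P 1 * (t· R) n ≈ 1ₛ n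
      telescope zero    = trans (+-congˡ (zeroʳ _))
        (trans (+-identityʳ _) (trans (*-cong P₀≈1 (*-identityˡ _)) (*-identityˡ _)))
      telescope (suc m) = solve 3 (λ s x p → (con 1ℤ :* con 1ℤ) :* ((:- con 1ℤ :* s) :* (x :* p))
                                             :+ ((x :* con 1ℤ) :* con 1ℤ) :* (s :* p) := con 0ℤ) refl _ _ _

    ∂-P : ∂ P ≋ cst α
    ∂-P zero    = solve 1 (λ x → (con 1ℤ :+ con 0ℤ) :* ((x :* con 1ℤ) :* con 1ℤ) := x) refl α
    ∂-P (suc n) = trans (*-congˡ (zeroʳ _)) (zeroʳ _)

    qS-0 : qS F 0 ≈ 1#
    qS-0 = trans (+-identityˡ _) (trans (*-identityˡ _) (trans (*-identityˡ _) invN-0))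

  module _ where
    open SetoidReasoning ≋-setoid

    invQ*qS≈1 : invQ F *ₛ qS F ≋ 1ₛ
    invQ*qS≈1 = begin
      invQ F *ₛ qS F                ≈⟨ *ₛ-cong {f = invQ F} ≋-refl
                                         (S.solve 1 (λ q → q S.:= S.con 1ℤ S.:- (S.con 1ℤ S.:- q)) ≋-refl (qS F)) ⟩
      invQ F *ₛ (1ₛ +ₛ -ₛ w)        ≈⟨ geometric-∘ₛ-inverse w
                                         (trans (+-congˡ (-‿cong qS-0)) (-‿inverseʳ _)) ⟩
      1ₛ                            ∎
      where
      w : Series F
      w = 1ₛ +ₛ -ₛ qS F

    Ĉ*P*dilated-logOverT≈1 : (Ĉ *ₛ P) *ₛ dilate α (logOverT F) ≋ 1ₛ
    Ĉ*P*dilated-logOverT≈1 = begin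
      (Ĉ *ₛ P) *ₛ dilate α (logOverT F)
        ≈⟨ *ₛ-cong {g = dilate α (logOverT F)} (≋-sym (dilate-*ₛ α (invQ F) (onePlusT F))) ≋-refl ⟩
      dilate α (invQ F *ₛ onePlusT F) *ₛ dilate α (logOverT F)
        ≈⟨ dilate-*ₛ α (invQ F *ₛ onePlusT F) (logOverT F) ⟨
      dilate α ((invQ F *ₛ onePlusT F) *ₛ logOverT F)
        ≈⟨ dilate-cong α (*ₛ-assoc (invQ F) (onePlusT F) (logOverT F)) ⟩
      dilate α (invQ F *ₛ qS F)
        ≈⟨ ≋-trans (dilate-cong α invQ*qS≈1) (dilate-1ₛ α) ⟩
      1ₛ
        ∎

    ∂-L≈Ĉ*L/t : ∂ L ≋ Ĉ *ₛ L/t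
    ∂-L≈Ĉ*L/t = ≋-sym (begin
      Ĉ *ₛ L/t                                ≈⟨ *ₛ-cong {f = Ĉ} ≋-refl L/t≈α*dilated-logOverT ⟩
      Ĉ *ₛ (cst α *ₛ D)                        ≈⟨ ≋-trans (≋-sym (*ₛ-identityʳ _))
                                                            (*ₛ-cong {f = Ĉ *ₛ (cst α *ₛ D)} ≋-refl (≋-sym P*R≈1)) ⟩
      (Ĉ *ₛ (cst α *ₛ D)) *ₛ (P *ₛ R)          ≈⟨ S.solve 5 (λ C c D P R → (C S.:* (c S.:* D)) S.:* (P S.:* R)
                                                     S.:= c S.:* (((C S.:* P) S.:* D) S.:* R)) ≋-refl Ĉ (cst α) D P R ⟩
      cst α *ₛ (((Ĉ *ₛ P) *ₛ D) *ₛ R)          ≈⟨ *ₛ-cong {f = cst α} ≋-refl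
                                                     (*ₛ-cong {g = R} Ĉ*P*dilated-logOverT≈1 ≋-refl) ⟩
      cst α *ₛ (1ₛ *ₛ R)                       ≈⟨ *ₛ-cong {f = cst α} ≋-refl (*ₛ-identityˡ R) ⟩
      cst α *ₛ R                               ≈⟨ ∂-L ⟨
      ∂ L                                      ∎)
      where
      D : Series F
      D = dilate α (logOverT F)

    ∂-E : ∀ x → ∂ (E x) ≋ E x *ₛ (cst (- x) *ₛ (cst α *ₛ R))
    ∂-E x = begin
      ∂ (E x)
        ≈⟨ ∂-∘ₛ (expCoeff F) (powX F a a≉0 x) (zeroʳ _) ⟩
      (∂ (expCoeff F) ∘ₛ powX F a a≉0 x) *ₛ ∂ (powX F a a≉0 x)
        ≈⟨ *ₛ-cong (∘ₛ-cong _ ∂-expCoeff) (∂-powX x) ⟩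
      E x *ₛ (cst (- x) *ₛ ∂ L)
        ≈⟨ *ₛ-cong {f = E x} ≋-refl (*ₛ-cong {f = cst (- x)} ≋-refl ∂-L) ⟩
      E x *ₛ (cst (- x) *ₛ (cst α *ₛ R))
        ∎

    P*∂R : P *ₛ ∂ R ≋ -ₛ (cst α *ₛ R)
    P*∂R = begin
      P *ₛ ∂ R
        ≈⟨ S.solve 2 (λ X Y → X S.:= (Y S.:+ X) S.:- Y) ≋-refl (P *ₛ ∂ R) (cst α *ₛ R) ⟩
      (cst α *ₛ R +ₛ P *ₛ ∂ R) +ₛ -ₛ (cst α *ₛ R)
        ≈⟨ +ₛ-cong (+ₛ-cong (*ₛ-cong {g = R} (≋-sym ∂-P) ≋-refl) ≋-refl) ≋-refl ⟩
      (∂ P *ₛ R +ₛ P *ₛ ∂ R) +ₛ -ₛ (cst α *ₛ R)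
        ≈⟨ +ₛ-cong (≋-trans (≋-sym (∂-*ₛ P R)) (≋-trans (∂-cong P*R≈1) ∂-1ₛ)) ≋-refl ⟩
      0ₛ +ₛ -ₛ (cst α *ₛ R)
        ≈⟨ (λ _ → +-identityˡ _) ⟩
      -ₛ (cst α *ₛ R)
        ∎

    E-coeff-0 : ∀ x → E x 0 ≈ 1#
    E-coeff-0 x = ∘ₛ-coeff-0 (expCoeff F) (powX F a a≉0 x)

    E-succ : ∀ x → E (x + 1#) ≋ E x *ₛ R
    E-succ x = linear-ODE-unique P γ P₀≈1 P-linear (E (x + 1#)) (E x *ₛ R) ode-E′ ode-E*R
      (trans (E-coeff-0 (x + 1#)) (sym (trans (*ₛ-coeff-0 (E x) R)
        (trans (*-congʳ (E-coeff-0 x)) (trans (*-identityˡ _) (*-identityˡ _))))))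
      where
      γ : Carrier
      γ = - (x + 1#) * α
      cx cα E′ : Series F
      cx = cst (- x)
      cα = cst α
      E′ = E (x + 1#)
      cγ≈[cx-1]*cα : cst γ ≋ (cx +ₛ -ₛ 1ₛ) *ₛ cα
      cγ≈[cx-1]*cα = ≋-trans (cst-* _ _) (*ₛ-cong {g = cα} -[x+1] ≋-refl)
        where
        -[x+1] : cst (- (x + 1#)) ≋ cx +ₛ -ₛ 1ₛ
        -[x+1] zero    = sym (-‿+-comm _ _)
        -[x+1] (suc n) = sym (trans (+-congˡ -0#≈0#) (+-identityʳ _))
      ode-E′ : P *ₛ ∂ E′ ≋ cst γ *ₛ E′
      ode-E′ = begin
        P *ₛ ∂ E′
          ≈⟨ *ₛ-cong {f = P} ≋-refl (∂-E (x + 1#)) ⟩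
        P *ₛ (E′ *ₛ (cst (- (x + 1#)) *ₛ (cα *ₛ R)))
          ≈⟨ S.solve 5 (λ P E c d R → P S.:* (E S.:* (c S.:* (d S.:* R)))
                                      S.:= (c S.:* d) S.:* (E S.:* (P S.:* R))) ≋-refl P E′ _ cα R ⟩
        (cst (- (x + 1#)) *ₛ cα) *ₛ (E′ *ₛ (P *ₛ R))
          ≈⟨ *ₛ-cong (≋-sym (cst-* _ _)) (*ₛ-cong {f = E′} ≋-refl P*R≈1) ⟩
        cst γ *ₛ (E′ *ₛ 1ₛ)
          ≈⟨ *ₛ-cong {f = cst γ} ≋-refl (*ₛ-identityʳ E′) ⟩
        cst γ *ₛ E′
          ∎
      ode-E*R : P *ₛ ∂ (E x *ₛ R) ≋ cst γ *ₛ (E x *ₛ R)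
      ode-E*R = begin
        P *ₛ ∂ (E x *ₛ R)
          ≈⟨ *ₛ-cong {f = P} ≋-refl
               (≋-trans (∂-*ₛ (E x) R) (+ₛ-cong (*ₛ-cong {g = R} (∂-E x) ≋-refl) ≋-refl)) ⟩
        P *ₛ ((E x *ₛ (cx *ₛ (cα *ₛ R))) *ₛ R +ₛ E x *ₛ ∂ R)
          ≈⟨ S.solve 6 (λ P E c d R DR → P S.:* ((E S.:* (c S.:* (d S.:* R))) S.:* R S.:+ E S.:* DR)
                  S.:= (c S.:* d) S.:* ((E S.:* R) S.:* (P S.:* R)) S.:+ E S.:* (P S.:* DR)) ≋-refl P (E x) cx cα R (∂ R) ⟩
        (cx *ₛ cα) *ₛ ((E x *ₛ R) *ₛ (P *ₛ R)) +ₛ E x *ₛ (P *ₛ ∂ R)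
          ≈⟨ +ₛ-cong (*ₛ-cong {f = cx *ₛ cα} ≋-refl (*ₛ-cong {f = E x *ₛ R} ≋-refl P*R≈1))
                     (*ₛ-cong {f = E x} ≋-refl P*∂R) ⟩
        (cx *ₛ cα) *ₛ ((E x *ₛ R) *ₛ 1ₛ) +ₛ E x *ₛ (-ₛ (cα *ₛ R))
          ≈⟨ S.solve 4 (λ E c d R → (c S.:* d) S.:* ((E S.:* R) S.:* S.con 1ℤ) S.:+ E S.:* (S.:- (d S.:* R))
                  S.:= ((c S.:- S.con 1ℤ) S.:* d) S.:* (E S.:* R)) ≋-refl (E x) cx cα R ⟩
        ((cx +ₛ -ₛ 1ₛ) *ₛ cα) *ₛ (E x *ₛ R)
          ≈⟨ *ₛ-cong {g = E x *ₛ R} cγ≈[cx-1]*cα ≋-refl ⟨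
        cst γ *ₛ (E x *ₛ R)
          ∎

    Λ-pred : ∀ k → Λ (k -ℤ 1ℤ) ≋ Λ k +ₛ Λ′ k *ₛ L
    Λ-pred k = begin
      Λ (k -ℤ 1ℤ)                       ≈⟨ ∘ₛ-cong L lif-pred ⟩
      (lif +ₛ t· ∂ lif) ∘ₛ L            ≈⟨ ∘ₛ-+ₛ lif (t· ∂ lif) L ⟩
      Λ k +ₛ (t· ∂ lif) ∘ₛ L            ≈⟨ +ₛ-cong ≋-refl (∘ₛ-*ₛ-inner (∂ lif) L refl) ⟨
      Λ k +ₛ Λ′ k *ₛ L                  ∎
      where
      lif : Series F
      lif = lifCoeff F k
      lif-pred : lifCoeff F (k -ℤ 1ℤ) ≋ lif +ₛ t· ∂ lif
      lif-pred j = trans (lifCoeff-pred k j)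
        (trans (distribʳ _ _ _) (+-cong (*-identityˡ _) (sym (t·-∂ lif j))))

    ∂-Λ : ∀ k → ∂ (Λ k) ≋ Λ′ k *ₛ (Ĉ *ₛ L/t)
    ∂-Λ k = ≋-trans (∂-∘ₛ (lifCoeff F k) L refl) (*ₛ-cong {f = Λ′ k} ≋-refl ∂-L≈Ĉ*L/t)

    ∂-G : ∀ k x → ∂ (G k x) ≋ -ₛ G k x +ₛ (cst (- x) *ₛ (cst α *ₛ G k (x + 1#)) +ₛ Ĉ *ₛ Y k x)
    ∂-G k x = begin
      ∂ (e *ₛ (Λ k *ₛ E x))
        ≈⟨ ≋-trans (∂-*ₛ e (Λ k *ₛ E x))
             (+ₛ-cong (*ₛ-cong {g = Λ k *ₛ E x} ∂-expNeg ≋-refl)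
                      (*ₛ-cong {f = e} ≋-refl (∂-*ₛ (Λ k) (E x)))) ⟩
      (-ₛ e) *ₛ (Λ k *ₛ E x) +ₛ e *ₛ (∂ (Λ k) *ₛ E x +ₛ Λ k *ₛ ∂ (E x))
        ≈⟨ +ₛ-cong ≋-refl (*ₛ-cong {f = e} ≋-refl
             (+ₛ-cong (*ₛ-cong {g = E x} (∂-Λ k) ≋-refl) (*ₛ-cong {f = Λ k} ≋-refl (∂-E x)))) ⟩
      (-ₛ e) *ₛ (Λ k *ₛ E x)
        +ₛ e *ₛ ((Λ′ k *ₛ (Ĉ *ₛ L/t)) *ₛ E x +ₛ Λ k *ₛ (E x *ₛ (cx *ₛ (cα *ₛ R))))
        ≈⟨ S.solve 9 (λ e Λ E Λ′ C l cx cα R →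
             (S.:- e) S.:* (Λ S.:* E) S.:+ e S.:* ((Λ′ S.:* (C S.:* l)) S.:* E S.:+ Λ S.:* (E S.:* (cx S.:* (cα S.:* R))))
             S.:= S.:- (e S.:* (Λ S.:* E)) S.:+ (cx S.:* (cα S.:* (e S.:* (Λ S.:* (E S.:* R))))
                   S.:+ C S.:* (e S.:* ((Λ′ S.:* l) S.:* E)))) ≋-refl e (Λ k) (E x) (Λ′ k) Ĉ L/t cx cα R ⟩
      -ₛ G k x +ₛ (cx *ₛ (cα *ₛ (e *ₛ (Λ k *ₛ (E x *ₛ R)))) +ₛ Ĉ *ₛ Y k x)
        ≈⟨ +ₛ-cong ≋-refl (+ₛ-cong (*ₛ-cong {f = cx} ≋-refl (*ₛ-cong {f = cα} ≋-refl (*ₛ-cong {f = e} ≋-refl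
             (*ₛ-cong {f = Λ k} ≋-refl (≋-sym (E-succ x)))))) ≋-refl) ⟩
      -ₛ G k x +ₛ (cx *ₛ (cα *ₛ G k (x + 1#)) +ₛ Ĉ *ₛ Y k x)
        ∎
      where
      e cx cα : Series F
      e = expNeg F
      cx = cst (- x)
      cα = cst α

    G-pred : ∀ k x → G (k -ℤ 1ℤ) x ≋ G k x +ₛ tₛ *ₛ Y k x
    G-pred k x = begin
      e *ₛ (Λ (k -ℤ 1ℤ) *ₛ E x)
        ≈⟨ *ₛ-cong {f = e} ≋-refl (*ₛ-cong {g = E x}
             (≋-trans (Λ-pred k) (+ₛ-cong ≋-refl (*ₛ-cong {f = Λ′ k} ≋-refl L≈t*L/t))) ≋-refl) ⟩
      e *ₛ ((Λ k +ₛ Λ′ k *ₛ (tₛ *ₛ L/t)) *ₛ E x)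
        ≈⟨ S.solve 6 (λ e Λ Λ′ t l E → e S.:* ((Λ S.:+ Λ′ S.:* (t S.:* l)) S.:* E)
                                       S.:= e S.:* (Λ S.:* E) S.:+ t S.:* (e S.:* ((Λ′ S.:* l) S.:* E)))
             ≋-refl e (Λ k) (Λ′ k) tₛ L/t (E x) ⟩
      G k x +ₛ tₛ *ₛ Y k x
        ∎
      where
      e : Series F
      e = expNeg F

  module _ where
    open import Relation.Binary.Reasoning.Setoid setoid

    Y-coeff : ∀ k x j → Y k x j ≈ G (k -ℤ 1ℤ) x (suc j) - G k x (suc j)
    Y-coeff k x j = begin
      Y k x j                                          ≈⟨ solve 2 (λ g y → y := (g :+ y) :- g) refl _ _ ⟩
      (G k x (suc j) + Y k x j) - G k x (suc j)        ≈⟨ +-congʳ (+-congˡ (tₛ-*ₛ (Y k x) (suc j))) ⟨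
      (G k x (suc j) + (tₛ *ₛ Y k x) (suc j)) - G k x (suc j) ≈⟨ +-congʳ (G-pred k x (suc j)) ⟨
      G (k -ℤ 1ℤ) x (suc j) - G k x (suc j)            ∎

    G-coeff-recurrence : ∀ k x m → natC (suc m) * G k x (suc m) ≈
      - G k x m + ((- x) * (α * G k (x + 1#) m)
                  + ∑ (λ l → Ĉ l * (G (k -ℤ 1ℤ) x (suc m ∸ l) - G k x (suc m ∸ l))) (suc m))
    G-coeff-recurrence k x m = trans (∂-G k x m) (+-congˡ (+-cong
      (trans (cst-*ₛ (- x) (cst α *ₛ G k (x + 1#)) m) (*-congˡ (cst-*ₛ α (G k (x + 1#)) m)))
      (∑-cong< (suc m) Y-shift)))
      where
      Y-shift : ∀ l → l < suc m →
        Ĉ l * Y k x (m ∸ l) ≈ Ĉ l * (G (k -ℤ 1ℤ) x (suc m ∸ l) - G k x (suc m ∸ l))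
      Y-shift l l<1+m rewrite ℕ.+-∸-assoc 1 (ℕ.≤-pred l<1+m) = *-congˡ (Y-coeff k x (m ∸ l))

    PC-recurrence : ∀ k x m → PC F a a≉0 k x (suc m) ≈
      ((- PC F a a≉0 k x m) - (α * x * PC F a a≉0 k (x + 1#) m))
        + (invN F m * ∑ (λ l → binom F (suc m) l * Chat F l * pw F α l
                              * (PC F a a≉0 (k -ℤ 1ℤ) x (suc m ∸ l) - PC F a a≉0 k x (suc m ∸ l))) (suc m))
    PC-recurrence k x m = begin
      natC (suc m ℕ.* m !) * g (suc m)
        ≈⟨ *-congʳ (K.natR-* (suc m) (m !)) ⟩
      (N * m!) * g (suc m)
        ≈⟨ solve 3 (λ n f y → (n :* f) :* y := f :* (n :* y)) refl N m! (g (suc m)) ⟩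
      m! * (N * g (suc m))
        ≈⟨ *-congˡ (G-coeff-recurrence k x m) ⟩
      m! * (- g m + ((- x) * (α * g′ m) + ∑ T (suc m)))
        ≈⟨ solve 6 (λ f g₀ x a g₁ s → f :* (:- g₀ :+ ((:- x) :* (a :* g₁) :+ s))
                                      := ((:- (f :* g₀)) :- (a :* x :* (f :* g₁))) :+ f :* s)
             refl m! (g m) x α (g′ m) (∑ T (suc m)) ⟩
      ((- (m! * g m)) - (α * x * (m! * g′ m))) + m! * ∑ T (suc m)
        ≈⟨ +-congˡ Cauchy-sum ⟨
      _ ∎
      where
      N m! : Carrier
      N = natC (suc m)
      m! = natC (m !)
      g g′ : Series F
      g = G k x
      g′ = G k (x + 1#)
      T : ℕ → Carrier
      T l = Ĉ l * (G (k -ℤ 1ℤ) x (suc m ∸ l) - g (suc m ∸ l))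
      binomial-term : ∀ l → l < suc m →
        binom F (suc m) l * Chat F l * pw F α l * (PC F a a≉0 (k -ℤ 1ℤ) x (suc m ∸ l) - PC F a a≉0 k x (suc m ∸ l))
          ≈ (N * m!) * T l
      binomial-term l l<1+m = begin
        binom F (suc m) l * (natC (l !) * invQ F l) * pw F α l * (r! * G (k -ℤ 1ℤ) x r - r! * g r)
          ≈⟨ solve 7 (λ b l! q p r! y z → b :* (l! :* q) :* p :* (r! :* y :- r! :* z)
                                           := (b :* (l! :* r!)) :* ((p :* q) :* (y :- z)))
               refl (binom F (suc m) l) (natC (l !)) (invQ F l) (pw F α l) r! (G (k -ℤ 1ℤ) x r) (g r) ⟩
        (binom F (suc m) l * (natC (l !) * r!)) * T l
          ≈⟨ *-congʳ (trans (K.natR-* (suc m C l) (l ! ℕ.* r !)) (*-congˡ (K.natR-* (l !) (r !)))) ⟨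
        natC ((suc m C l) ℕ.* (l ! ℕ.* r !)) * T l
          ≡⟨ ≡.cong (λ n → natC n * T l) (nCk*[k!*[n∸k]!]≡n! (ℕ.<⇒≤ l<1+m)) ⟩
        natC (suc m ℕ.* m !) * T l
          ≈⟨ *-congʳ (K.natR-* (suc m) (m !)) ⟩
        (N * m!) * T l
          ∎
        where
        r : ℕ
        r = suc m ∸ l
        r! : Carrier
        r! = natC (r !)
      Cauchy-sum : invN F m * ∑ (λ l → binom F (suc m) l * Chat F l * pw F α l
                     * (PC F a a≉0 (k -ℤ 1ℤ) x (suc m ∸ l) - PC F a a≉0 k x (suc m ∸ l))) (suc m)
                   ≈ m! * ∑ T (suc m)
      Cauchy-sum = begin
        invN F m * ∑ _ (suc m)                   ≈⟨ *-congˡ (∑-cong< (suc m) binomial-term) ⟩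
        invN F m * ∑ (λ l → (N * m!) * T l) (suc m) ≈⟨ *-congˡ (*-distribˡ-∑ (N * m!) T (suc m)) ⟨
        invN F m * ((N * m!) * ∑ T (suc m))      ≈⟨ solve 4 (λ i n f s → i :* ((n :* f) :* s) := (n :* i) :* (f :* s))
                                                      refl (invN F m) N m! (∑ T (suc m)) ⟩
        (N * invN F m) * (m! * ∑ T (suc m))      ≈⟨ trans (*-congʳ (natC*invN m)) (*-identityˡ _) ⟩
        m! * ∑ T (suc m)                         ∎

theorem6 : {c ℓ : Level} (F : CharZeroField c ℓ) →
  let open CharZeroField F in
  (a : Carrier) (a≉0 : ¬ (a ≈ 0#)) (k : ℤ) (x : Carrier) (n : ℕ) → 1 ≤ n →
    PC F a a≉0 k x n ≈
      (((- PC F a a≉0 k x (n ∸ 1))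
        - (ainv F a a≉0 * x * PC F a a≉0 k (x + 1#) (n ∸ 1)))
        + (invN F (n ∸ 1) *
            sumTo F (λ l → binom F n l * Chat F l * pw F (ainv F a a≉0) l
              * (PC F a a≉0 (k -ℤ 1ℤ) x (n ∸ l) - PC F a a≉0 k x (n ∸ l))) n))
theorem6 F a a≉0 k x (suc m) (s≤s z≤n) = PC-Recurrence.PC-recurrence F a a≉0 k x m
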